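{- The following two statements are equivalent: (i) for every finite simple graph $G$, $\eta(G) \ge \chi(G)$; (ii) for every finite simple chordal graph $H$, $\eta(H^2) \ge \chi(H^2)$.
   Context: All graphs are finite, undirected and simple. $\chi(G)$ denotes the chromatic number of $G$. A graph $M$ is a minor of $G$ if a graph isomorphic to $M$ can be obtained from a subgraph of $G$ by contracting edges; the Hadwiger number $\eta(G)$ is the largest integer $t$ such that $G$ has a minor isomorphic to the complete graph $K_t$. A chordal graph is a graph with no induced cycle of length at least $4$. The square $G^2$ of a graph $G$ is the graph on $V(G)$ in which two distinct vertices are adjacent if and only if their distance in $G$ is $1$ or $2$. -}

module Defs where

open import Data.Nat using (ℕ; zero; suc; _+_; _≤_; _%_)
open import Data.Fin using (Fin; toℕ)
open import Data.Maybe using (Maybe; just)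
open import Data.Product using (Σ; ∃; _×_; _,_)
open import Data.Sum using (_⊎_)
open import Data.Empty using (⊥)
open import Relation.Nullary using (¬_)
open import Relation.Binary.PropositionalEquality using (_≡_; _≢_)
open import Function.Bundles using (_⇔_)
open import Function.Definitions using (Injective)

record Graph (n : ℕ) : Set₁ where
  field
    Adj   : Fin n → Fin n → Set
    sym   : ∀ {u v} → Adj u v → Adj v u
    irrefl : ∀ {u} → ¬ Adj u u
open Graph public

Colorable : ∀ {n} → Graph n → ℕ → Set
Colorable {n} G k =
  Σ (Fin n → Fin k) λ c → ∀ {u v} → Adj G u v → c u ≢ c v

IsChromaticNumber : ∀ {n} → Graph n → ℕ → Set
IsChromaticNumber G k = Colorable G k × (∀ j → Colorable G j → k ≤ j)

data WalkIn {n} (G : Graph n) (P : Fin n → Set) : Fin n → Fin n → Set where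
  here : ∀ {u} → P u → WalkIn G P u u
  step : ∀ {u w v} → P u → Adj G u w → WalkIn G P w v → WalkIn G P u v

-- A K_t minor of G, given by a model: branch sets B_1..B_t
-- (vertex v lies in branch i iff β v ≡ just i, so branch sets are disjoint),
-- each nonempty and connected, and any two distinct branch sets joined by an edge.
record CliqueMinor {n} (G : Graph n) (t : ℕ) : Set where
  field
    β          : Fin n → Maybe (Fin t)
    nonempty   : ∀ i → ∃ λ v → β v ≡ just i
    connected  : ∀ i u v → β u ≡ just i → β v ≡ just i →
                 WalkIn G (λ w → β w ≡ just i) u v
    adjacent   : ∀ i j → i ≢ j →
                 ∃ λ u → ∃ λ v → β u ≡ just i × β v ≡ just j × Adj G u v

HasCliqueMinor : ∀ {n} → Graph n → ℕ → Set
HasCliqueMinor G t = CliqueMinor G t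

IsHadwigerNumber : ∀ {n} → Graph n → ℕ → Set
IsHadwigerNumber G t = HasCliqueMinor G t × (∀ s → HasCliqueMinor G s → s ≤ t)

HadwigerHolds : ∀ {n} → Graph n → Set
HadwigerHolds G = ∀ χ η → IsChromaticNumber G χ → IsHadwigerNumber G η → χ ≤ η

CycAdj : ∀ {p} → Fin (suc p) → Fin (suc p) → Set
CycAdj {p} i j = toℕ j ≡ suc (toℕ i) % suc p ⊎ toℕ i ≡ suc (toℕ j) % suc p

InducedCycle : ∀ {n} → Graph n → ℕ → Set
InducedCycle {n} G m =
  Σ (Fin (4 + m) → Fin n) λ f →
    Injective _≡_ _≡_ f × (∀ i j → Adj G (f i) (f j) ⇔ CycAdj i j)

Chordal : ∀ {n} → Graph n → Set
Chordal G = ∀ m → ¬ InducedCycle G m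

square : ∀ {n} → Graph n → Graph n
square G = record
  { Adj = λ u v → u ≢ v × (Adj G u v ⊎ ∃ λ w → Adj G u w × Adj G w v)
  ; sym = λ { (ne , Data.Sum.inj₁ a) → (λ e → ne (Relation.Binary.PropositionalEquality.sym e)) , Data.Sum.inj₁ (Graph.sym G a)
            ; (ne , Data.Sum.inj₂ (w , a , b)) → (λ e → ne (Relation.Binary.PropositionalEquality.sym e)) , Data.Sum.inj₂ (w , Graph.sym G b , Graph.sym G a) }
  ; irrefl = λ { (ne , _) → ne Relation.Binary.PropositionalEquality.refl }
  }

module Submission where

-- For (ii) ⇒ (i), build from G on n vertices a split graph H:
-- a clique with one vertex (u , v) for each ordered pair of vertices of G, and an
-- independent copy of V(G), where x sees (u , v) iff x = u, or x = v and uv ∈ E(G).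
-- H is chordal as every split graph is: the ends of an induced P₄ lie on the
-- independent side, and an induced cycle of length ≥ 4 has two adjacent such ends.
-- Two vertices of G have a common neighbour in H iff they are adjacent in G, and each
-- clique vertex is within distance 2 of x through (x , x); so H² is G joined with
-- K_{n²}, i.e. G with n² universal vertices added. A universal vertex raises both χ
-- and η by exactly one (a K_{t+1} model in the cone loses at most the branch set of
-- the apex), so η(H²) ≥ χ(H²) gives η(G) ≥ χ(G).

open import Defs
open import Data.Bool using (Bool; true; false)
open import Data.Nat using (ℕ; zero; suc; _+_; _*_; _≤_; z≤n; s≤s)
open import Data.Nat.Properties using (≤-pred)
open import Data.Fin using (Fin; zero; suc; #_; punchIn; punchOut; splitAt; join; remQuot; combine; _≟_)
open import Data.Fin.Properties using (suc-injective; punchIn-punchOut; punchOut-punchIn; punchInᵢ≢i; punchIn-injective; punchOut-injective; punchOut-cong; splitAt-join; join-splitAt; remQuot-combine)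
open import Data.Maybe using (Maybe; just; nothing; _>>=_)
import Data.Maybe as Maybe
open import Data.Maybe.Properties using (map-injective)
open import Data.Product using (∃; _×_; _,_)
import Data.Product as Product
open import Data.Sum using (_⊎_; inj₁; inj₂; [_,_]′)
import Data.Sum as Sum
open import Data.Unit using (⊤; tt)
open import Data.Empty using (⊥; ⊥-elim)
open import Function using (_∘_; id; const)
open import Relation.Nullary using (¬_; yes; no; contradiction)
open import Relation.Binary.PropositionalEquality using (_≡_; _≢_; refl; cong; trans; subst; module ≡-Reasoning)
  renaming (sym to ≡-sym)
open import Function.Bundles using (_⇔_; mk⇔; Equivalence)
import Function.Properties.Equivalence as ⇔

private
  variable
    n t k : ℕ

walk-head : ∀ {G : Graph n} {P u v} → WalkIn G P u v → P u
walk-head (here p)     = p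
walk-head (step p _ _) = p

walk-map : ∀ {m} {G : Graph n} {G′ : Graph m} {P Q} (f : Fin n → Fin m) →
           (∀ {u v} → Adj G u v → Adj G′ (f u) (f v)) → (∀ {u} → P u → Q (f u)) →
           ∀ {u v} → WalkIn G P u v → WalkIn G′ Q (f u) (f v)
walk-map f adj inP (here p)     = here (inP p)
walk-map f adj inP (step p a w) = step (inP p) (adj a) (walk-map f adj inP w)

infix 4 _≈_
record _≈_ (G G′ : Graph n) : Set where
  constructor mk≈
  field adj⇔ : ∀ u v → Adj G u v ⇔ Adj G′ u v
open _≈_

≈-sym : {G G′ : Graph n} → G ≈ G′ → G′ ≈ G
≈-sym G≈G′ = mk≈ λ u v → ⇔.sym (adj⇔ G≈G′ u v)

module _ {G G′ : Graph n} (G≈G′ : G ≈ G′) where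

  private
    adj : ∀ {u v} → Adj G u v → Adj G′ u v
    adj {u} {v} = Equivalence.to (adj⇔ G≈G′ u v)

  Colorable-≈ : Colorable G k → Colorable G′ k
  Colorable-≈ (c , proper) = c , λ {u} {v} a → proper (Equivalence.from (adj⇔ G≈G′ u v) a)

  CliqueMinor-≈ : CliqueMinor G t → CliqueMinor G′ t
  CliqueMinor-≈ M = record
    { β         = β
    ; nonempty  = nonempty
    ; connected = λ i u v p q → walk-map id adj id (connected i u v p q)
    ; adjacent  = λ i j i≢j → let u , v , p , q , a = adjacent i j i≢j in u , v , p , q , adj a
    }
    where open CliqueMinor M

module _ {G G′ : Graph n} (G≈G′ : G ≈ G′) where

  IsChromaticNumber-≈ : ∀ {χ} → IsChromaticNumber G χ → IsChromaticNumber G′ χ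
  IsChromaticNumber-≈ (col , least) =
    Colorable-≈ G≈G′ col , λ j col′ → least j (Colorable-≈ (≈-sym G≈G′) col′)

  IsHadwigerNumber-≈ : ∀ {η} → IsHadwigerNumber G η → IsHadwigerNumber G′ η
  IsHadwigerNumber-≈ (M , greatest) =
    CliqueMinor-≈ G≈G′ M , λ s M′ → greatest s (CliqueMinor-≈ (≈-sym G≈G′) M′)

HadwigerHolds-≈ : {G G′ : Graph n} → G ≈ G′ → HadwigerHolds G → HadwigerHolds G′
HadwigerHolds-≈ G≈G′ h χ η χ-G′ η-G′ =
  h χ η (IsChromaticNumber-≈ (≈-sym G≈G′) χ-G′) (IsHadwigerNumber-≈ (≈-sym G≈G′) η-G′)

coneAdj : Graph n → Fin (suc n) → Fin (suc n) → Set
coneAdj G zero    zero    = ⊥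
coneAdj G zero    (suc _) = ⊤
coneAdj G (suc _) zero    = ⊤
coneAdj G (suc u) (suc v) = Adj G u v

cone : Graph n → Graph (suc n)
cone G = record { Adj = coneAdj G ; sym = λ {u} {v} → coneAdj-sym u v ; irrefl = λ {u} → coneAdj-irrefl u }
  where
  coneAdj-sym : ∀ u v → coneAdj G u v → coneAdj G v u
  coneAdj-sym zero    (suc _) _ = tt
  coneAdj-sym (suc _) zero    _ = tt
  coneAdj-sym (suc u) (suc v) a = Graph.sym G a

  coneAdj-irrefl : ∀ u → ¬ coneAdj G u u
  coneAdj-irrefl zero    ()
  coneAdj-irrefl (suc u) = Graph.irrefl G

module _ {G : Graph n} where

  cone-colorable : Colorable G k → Colorable (cone G) (suc k)
  cone-colorable {k} (c , proper) = c′ , λ {u} {v} → proper′ u v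
    where
    c′ : Fin (suc n) → Fin (suc k)
    c′ zero    = zero
    c′ (suc v) = suc (c v)

    proper′ : ∀ u v → coneAdj G u v → c′ u ≢ c′ v
    proper′ zero    (suc _) _  ()
    proper′ (suc _) zero    _  ()
    proper′ (suc u) (suc v) uv = proper uv ∘ suc-injective

  -- The apex colour is missing from every other vertex, so it can be punched out.
  cone-colorable⁻ : Colorable (cone G) (suc k) → Colorable G k
  cone-colorable⁻ (c , proper) =
    (λ v → punchOut (apex≢ v)) , λ uv → proper uv ∘ punchOut-injective (apex≢ _) (apex≢ _)
    where
    apex≢ : ∀ v → c zero ≢ c (suc v)
    apex≢ v = proper {zero} {suc v} tt

  IsChromaticNumber-cone : ∀ {χ} → IsChromaticNumber G χ → IsChromaticNumber (cone G) (suc χ)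
  IsChromaticNumber-cone {χ} (col , least) = cone-colorable col , least′
    where
    least′ : ∀ j → Colorable (cone G) j → suc χ ≤ j
    least′ zero    (c , _) with c zero
    ... | ()
    least′ (suc j) col′ = s≤s (least j (cone-colorable⁻ col′))

removeIndex : Fin (suc t) → Fin (suc t) → Maybe (Fin t)
removeIndex i j with i ≟ j
... | yes _   = nothing
... | no i≢j = just (punchOut i≢j)

removeIndex-self : (i : Fin (suc t)) → removeIndex i i ≡ nothing
removeIndex-self i with i ≟ i
... | yes _   = refl
... | no i≢i = contradiction refl i≢i

removeIndex-punchIn : (i : Fin (suc t)) (j : Fin t) → removeIndex i (punchIn i j) ≡ just j
removeIndex-punchIn i j with i ≟ punchIn i j
... | yes i≡punchIn = contradiction (≡-sym i≡punchIn) (punchInᵢ≢i i j)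
... | no _          = cong just (trans (punchOut-cong i refl) (punchOut-punchIn i))

bind-removeIndex-just : (i : Fin (suc t)) (m : Maybe (Fin (suc t))) {j : Fin t} →
                        (m >>= removeIndex i) ≡ just j → m ≡ just (punchIn i j)
bind-removeIndex-just i (just k) e with i ≟ k
bind-removeIndex-just i (just k) refl | no i≢k = cong just (≡-sym (punchIn-punchOut i≢k))

deleteBranch : {G : Graph n} → Fin (suc t) → CliqueMinor G (suc t) → CliqueMinor G t
deleteBranch {n} {t} {G} i M = record
  { β         = β′
  ; nonempty  = λ j → Product.map₂ inBranch (nonempty (punchIn i j))
  ; connected = λ j u v p q →
      walk-map id id inBranch (connected (punchIn i j) u v (fromBranch p) (fromBranch q))
  ; adjacent  = adjacent′
  }
  where
  open CliqueMinor M
  β′ : Fin n → Maybe (Fin t)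
  β′ v = β v >>= removeIndex i

  inBranch : ∀ {v j} → β v ≡ just (punchIn i j) → β′ v ≡ just j
  inBranch {j = j} e = trans (cong (_>>= removeIndex i) e) (removeIndex-punchIn i j)

  fromBranch : ∀ {v j} → β′ v ≡ just j → β v ≡ just (punchIn i j)
  fromBranch {v} = bind-removeIndex-just i (β v)

  adjacent′ : ∀ j j′ → j ≢ j′ → ∃ λ u → ∃ λ v → β′ u ≡ just j × β′ v ≡ just j′ × Adj G u v
  adjacent′ j j′ j≢j′ with adjacent (punchIn i j) (punchIn i j′) (j≢j′ ∘ punchIn-injective i j j′)
  ... | u , v , p , q , a = u , v , inBranch p , inBranch q , a

module _ {G : Graph n} where

  walk-uncone : ∀ {P} → ¬ P zero → ∀ {u v} → WalkIn (cone G) P (suc u) (suc v) → WalkIn G (P ∘ suc) u v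
  walk-uncone ¬P₀ (here p)                  = here p
  walk-uncone ¬P₀ (step {w = zero}  _ _ w) = ⊥-elim (¬P₀ (walk-head w))
  walk-uncone ¬P₀ (step {w = suc _} p a w) = step p a (walk-uncone ¬P₀ w)

  uncone-minor : (M : CliqueMinor (cone G) t) → CliqueMinor.β M zero ≡ nothing → CliqueMinor G t
  uncone-minor {t} M apex∉ = record
    { β         = β ∘ suc
    ; nonempty  = nonempty′
    ; connected = λ i u v p q → walk-uncone apex∉branch (connected i (suc u) (suc v) p q)
    ; adjacent  = adjacent′
    }
    where
    open CliqueMinor M
    apex∉branch : ∀ {i} → β zero ≢ just i
    apex∉branch e with trans (≡-sym apex∉) e
    ... | ()

    nonempty′ : ∀ i → ∃ λ v → β (suc v) ≡ just i
    nonempty′ i with nonempty i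
    ... | zero  , e = ⊥-elim (apex∉branch e)
    ... | suc v , e = v , e

    adjacent′ : ∀ i j → i ≢ j → ∃ λ u → ∃ λ v → β (suc u) ≡ just i × β (suc v) ≡ just j × Adj G u v
    adjacent′ i j i≢j with adjacent i j i≢j
    ... | zero  , _     , p , _ , _ = ⊥-elim (apex∉branch p)
    ... | suc _ , zero  , _ , q , _ = ⊥-elim (apex∉branch q)
    ... | suc u , suc v , p , q , a = u , v , p , q , a

  cone-minor : CliqueMinor G t → CliqueMinor (cone G) (suc t)
  cone-minor {t} M = record
    { β         = β′
    ; nonempty  = nonempty′
    ; connected = connected′
    ; adjacent  = adjacent′
    }
    where
    open CliqueMinor M
    β′ : Fin (suc n) → Maybe (Fin (suc t))
    β′ zero    = just zero
    β′ (suc v) = Maybe.map suc (β v)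

    lift : ∀ {v i} → β v ≡ just i → β′ (suc v) ≡ just (suc i)
    lift = cong (Maybe.map suc)

    unlift : ∀ {v i} → β′ (suc v) ≡ just (suc i) → β v ≡ just i
    unlift = map-injective suc-injective

    old∉apexBranch : ∀ v → β′ (suc v) ≢ just zero
    old∉apexBranch v e with β v
    old∉apexBranch v () | nothing
    old∉apexBranch v () | just _

    nonempty′ : ∀ i → ∃ λ v → β′ v ≡ just i
    nonempty′ zero    = zero , refl
    nonempty′ (suc i) = Product.map suc lift (nonempty i)

    connected′ : ∀ i u v → β′ u ≡ just i → β′ v ≡ just i → WalkIn (cone G) (λ w → β′ w ≡ just i) u v
    connected′ zero    zero    zero    _ _ = here refl
    connected′ zero    zero    (suc v) _ q = ⊥-elim (old∉apexBranch v q)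
    connected′ zero    (suc u) _       p _ = ⊥-elim (old∉apexBranch u p)
    connected′ (suc i) zero    _       () _
    connected′ (suc i) (suc u) zero    _ ()
    connected′ (suc i) (suc u) (suc v) p q =
      walk-map suc id lift (connected i u v (unlift p) (unlift q))

    adjacent′ : ∀ i j → i ≢ j → ∃ λ u → ∃ λ v → β′ u ≡ just i × β′ v ≡ just j × Adj (cone G) u v
    adjacent′ zero    zero    i≢j = contradiction refl i≢j
    adjacent′ zero    (suc j) _   with nonempty j
    ... | v , e = zero , suc v , refl , lift e , tt
    adjacent′ (suc i) zero    _   with nonempty i
    ... | u , e = suc u , zero , lift e , refl , tt
    adjacent′ (suc i) (suc j) i≢j with adjacent i j (i≢j ∘ cong suc)
    ... | u , v , p , q , a = suc u , suc v , lift p , lift q , a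

  -- Delete the branch set containing the apex, or an arbitrary one if there is none.
  cone-minor⁻ : CliqueMinor (cone G) (suc t) → CliqueMinor G t
  cone-minor⁻ M with CliqueMinor.β M zero in apex
  ... | nothing = uncone-minor (deleteBranch zero M) (cong (_>>= removeIndex zero) apex)
  ... | just i  = uncone-minor (deleteBranch i M) (trans (cong (_>>= removeIndex i) apex) (removeIndex-self i))

  IsHadwigerNumber-cone : ∀ {η} → IsHadwigerNumber G η → IsHadwigerNumber (cone G) (suc η)
  IsHadwigerNumber-cone {η} (M , greatest) = cone-minor M , greatest′
    where
    greatest′ : ∀ s → HasCliqueMinor (cone G) s → s ≤ suc η
    greatest′ zero    _  = z≤n
    greatest′ (suc s) M′ = s≤s (greatest s (cone-minor⁻ M′))

  HadwigerHolds-cone⁻ : HadwigerHolds (cone G) → HadwigerHolds G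
  HadwigerHolds-cone⁻ h χ η χ-G η-G =
    ≤-pred (h (suc χ) (suc η) (IsChromaticNumber-cone χ-G) (IsHadwigerNumber-cone η-G))

cones : ∀ k → Graph n → Graph (k + n)
cones zero    G = G
cones (suc k) G = cone (cones k G)

HadwigerHolds-cones⁻ : ∀ k {G : Graph n} → HadwigerHolds (cones k G) → HadwigerHolds G
HadwigerHolds-cones⁻ zero    h = h
HadwigerHolds-cones⁻ (suc k) h = HadwigerHolds-cones⁻ k (HadwigerHolds-cone⁻ h)

JoinAdj : Graph n → Fin k ⊎ Fin n → Fin k ⊎ Fin n → Set
JoinAdj G (inj₁ p) (inj₁ q) = p ≢ q
JoinAdj G (inj₁ _) (inj₂ _) = ⊤
JoinAdj G (inj₂ _) (inj₁ _) = ⊤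
JoinAdj G (inj₂ x) (inj₂ y) = Adj G x y

module _ (G : Graph n) where

  JoinAdj⇒≢ : ∀ (a b : Fin k ⊎ Fin n) → JoinAdj G a b → a ≢ b
  JoinAdj⇒≢ (inj₁ p) (inj₁ .p) p≢p refl = p≢p refl
  JoinAdj⇒≢ (inj₂ x) (inj₂ .x) x~x refl = Graph.irrefl G x~x

  JoinAdj-suc : ∀ (a b : Fin k ⊎ Fin n) → JoinAdj G a b ⇔ JoinAdj G (Sum.map₁ suc a) (Sum.map₁ suc b)
  JoinAdj-suc (inj₁ p) (inj₁ q) = mk⇔ (λ p≢q → p≢q ∘ suc-injective) (λ p≢q → p≢q ∘ cong suc)
  JoinAdj-suc (inj₁ _) (inj₂ _) = ⇔.refl
  JoinAdj-suc (inj₂ _) (inj₁ _) = ⇔.refl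
  JoinAdj-suc (inj₂ _) (inj₂ _) = ⇔.refl

  JoinAdj-zeroˡ : ∀ (b : Fin k ⊎ Fin n) → JoinAdj G (inj₁ zero) (Sum.map₁ suc b)
  JoinAdj-zeroˡ (inj₁ _) ()
  JoinAdj-zeroˡ (inj₂ _) = tt

  JoinAdj-zeroʳ : ∀ (a : Fin k ⊎ Fin n) → JoinAdj G (Sum.map₁ suc a) (inj₁ zero)
  JoinAdj-zeroʳ (inj₁ _) ()
  JoinAdj-zeroʳ (inj₂ _) = tt

  cones-Adj : ∀ k u v → Adj (cones k G) u v ⇔ JoinAdj G (splitAt k u) (splitAt k v)
  cones-Adj zero    u       v       = ⇔.refl
  cones-Adj (suc k) zero    zero    = mk⇔ ⊥-elim (λ 0≢0 → 0≢0 refl)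
  cones-Adj (suc k) zero    (suc v) = mk⇔ (λ _ → JoinAdj-zeroˡ (splitAt k v)) (λ _ → tt)
  cones-Adj (suc k) (suc u) zero    = mk⇔ (λ _ → JoinAdj-zeroʳ (splitAt k u)) (λ _ → tt)
  cones-Adj (suc k) (suc u) (suc v) = ⇔.trans (cones-Adj k u v) (JoinAdj-suc (splitAt k u) (splitAt k v))

module SplitPartition (G : Graph n) (inClique : Fin n → Bool)
  (clique      : ∀ {u v} → inClique u ≡ true → inClique v ≡ true → u ≢ v → Adj G u v)
  (independent : ∀ {u v} → inClique u ≡ false → inClique v ≡ false → ¬ Adj G u v) where

  inducedPath-end : ∀ {a b c d} → Adj G a b → Adj G b c → Adj G c d → a ≢ c → b ≢ d →
                    ¬ Adj G a c → ¬ Adj G b d → inClique a ≡ false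
  inducedPath-end {a} {b} {c} {d} ab bc cd a≢c b≢d a≁c b≁d
    with inClique a in ea | inClique c in ec
  ... | false | _     = refl
  ... | true  | true  = contradiction (clique ea ec a≢c) a≁c
  ... | true  | false with inClique b in eb | inClique d in ed
  ...   | false | _     = contradiction bc (independent eb ec)
  ...   | true  | false = contradiction cd (independent ec ed)
  ...   | true  | true  = contradiction (clique eb ed b≢d) b≁d

  module Cycle {m} (f : Fin (4 + m) → Fin n) (f-injective : ∀ {i j} → f i ≡ f j → i ≡ j)
           (f-induced : ∀ i j → Adj G (f i) (f j) ⇔ CycAdj i j) where

    cycle-edge : ∀ i j → CycAdj i j → Adj G (f i) (f j)
    cycle-edge i j = Equivalence.from (f-induced i j)

    path-end : ∀ i j k l → CycAdj i j → CycAdj j k → CycAdj k l → i ≢ k → j ≢ l →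
               ¬ CycAdj i k → ¬ CycAdj j l → inClique (f i) ≡ false
    path-end i j k l ij jk kl i≢k j≢l i≁k j≁l =
      inducedPath-end (cycle-edge i j ij) (cycle-edge j k jk) (cycle-edge k l kl)
        (i≢k ∘ f-injective) (j≢l ∘ f-injective)
        (i≁k ∘ Equivalence.to (f-induced i k)) (j≁l ∘ Equivalence.to (f-induced j l))

  -- 5 % (5 + m) only reduces once m is known to be zero or a successor.
  ¬CycAdj-2-4 : ∀ m → ¬ CycAdj {4 + m} (# 2) (# 4)
  ¬CycAdj-2-4 zero    = λ { (inj₁ ()) ; (inj₂ ()) }
  ¬CycAdj-2-4 (suc m) = λ { (inj₁ ()) ; (inj₂ ()) }

  chordal : Chordal G
  chordal zero (f , f-injective , f-induced) = independent f₀∉ f₃∉ (cycle-edge (# 0) (# 3) (inj₂ refl))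
    where
    open Cycle f f-injective f-induced
    f₀∉ : inClique (f (# 0)) ≡ false
    f₀∉ = path-end (# 0) (# 1) (# 2) (# 3) (inj₁ refl) (inj₁ refl) (inj₁ refl) (λ ()) (λ ())
            (λ { (inj₁ ()) ; (inj₂ ()) }) (λ { (inj₁ ()) ; (inj₂ ()) })
    f₃∉ : inClique (f (# 3)) ≡ false
    f₃∉ = path-end (# 3) (# 2) (# 1) (# 0) (inj₂ refl) (inj₂ refl) (inj₂ refl) (λ ()) (λ ())
            (λ { (inj₁ ()) ; (inj₂ ()) }) (λ { (inj₁ ()) ; (inj₂ ()) })
  chordal (suc m) (f , f-injective , f-induced) = independent f₀∉ f₁∉ (cycle-edge (# 0) (# 1) (inj₁ refl))
    where
    open Cycle f f-injective f-induced
    f₀∉ : inClique (f (# 0)) ≡ false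
    f₀∉ = path-end (# 0) (# 1) (# 2) (# 3) (inj₁ refl) (inj₁ refl) (inj₁ refl) (λ ()) (λ ())
            (λ { (inj₁ ()) ; (inj₂ ()) }) (λ { (inj₁ ()) ; (inj₂ ()) })
    f₁∉ : inClique (f (# 1)) ≡ false
    f₁∉ = path-end (# 1) (# 2) (# 3) (# 4) (inj₁ refl) (inj₁ refl) (inj₁ refl) (λ ()) (λ ())
            (λ { (inj₁ ()) ; (inj₂ ()) }) (¬CycAdj-2-4 m)

splitAt-injective : ∀ m {n} {u v : Fin (m + n)} → splitAt m u ≡ splitAt m v → u ≡ v
splitAt-injective m {n} {u} {v} e = begin
  u                      ≡⟨ ≡-sym (join-splitAt m n u) ⟩
  join m n (splitAt m u) ≡⟨ cong (join m n) e ⟩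
  join m n (splitAt m v) ≡⟨ join-splitAt m n v ⟩
  v                      ∎
  where open ≡-Reasoning

isInj₁ : {A B : Set} → A ⊎ B → Bool
isInj₁ = [ const true , const false ]′

module SplitConstruction (G : Graph n) where

  K : ℕ
  K = n * n

  Incident : Fin n → Fin n × Fin n → Set
  Incident x (u , v) = x ≡ u ⊎ (x ≡ v × Adj G u v)

  SplitAdj : Fin K ⊎ Fin n → Fin K ⊎ Fin n → Set
  SplitAdj (inj₁ p) (inj₁ q) = p ≢ q
  SplitAdj (inj₁ p) (inj₂ x) = Incident x (remQuot n p)
  SplitAdj (inj₂ x) (inj₁ p) = Incident x (remQuot n p)
  SplitAdj (inj₂ _) (inj₂ _) = ⊥

  SplitAdj-sym : ∀ a b → SplitAdj a b → SplitAdj b a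
  SplitAdj-sym (inj₁ p) (inj₁ q) p≢q = p≢q ∘ ≡-sym
  SplitAdj-sym (inj₁ p) (inj₂ x) i   = i
  SplitAdj-sym (inj₂ x) (inj₁ p) i   = i

  SplitAdj-irrefl : ∀ a → ¬ SplitAdj a a
  SplitAdj-irrefl (inj₁ p) p≢p = p≢p refl

  splitGraph : Graph (K + n)
  splitGraph = record
    { Adj    = λ u v → SplitAdj (splitAt K u) (splitAt K v)
    ; sym    = λ {u} {v} → SplitAdj-sym (splitAt K u) (splitAt K v)
    ; irrefl = λ {u} → SplitAdj-irrefl (splitAt K u)
    }

  splitGraph-chordal : Chordal splitGraph
  splitGraph-chordal = SplitPartition.chordal splitGraph (isInj₁ ∘ splitAt K)
    (λ {u} {v} eu ev u≢v → clique (splitAt K u) (splitAt K v) eu ev (u≢v ∘ splitAt-injective K))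
    (λ {u} {v} → independent (splitAt K u) (splitAt K v))
    where
    clique : ∀ a b → isInj₁ a ≡ true → isInj₁ b ≡ true → a ≢ b → SplitAdj a b
    clique (inj₁ p) (inj₁ q) _ _ a≢b = a≢b ∘ cong inj₁

    independent : ∀ a b → isInj₁ a ≡ false → isInj₁ b ≡ false → ¬ SplitAdj a b
    independent (inj₂ _) (inj₂ _) _ _ ()

  Within2 : Fin K ⊎ Fin n → Fin K ⊎ Fin n → Set
  Within2 a b = SplitAdj a b ⊎ ∃ λ w → SplitAdj a w × SplitAdj w b

  Within2-sym : ∀ a b → Within2 a b → Within2 b a
  Within2-sym a b (inj₁ ab)             = inj₁ (SplitAdj-sym a b ab)
  Within2-sym a b (inj₂ (w , aw , wb)) = inj₂ (w , SplitAdj-sym w b wb , SplitAdj-sym a w aw)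

  common-neighbour : ∀ {x y} e → x ≢ y → Incident x e → Incident y e → Adj G x y
  common-neighbour _ x≢y (inj₁ refl)        (inj₁ refl)        = contradiction refl x≢y
  common-neighbour _ _   (inj₁ refl)        (inj₂ (refl , uv)) = uv
  common-neighbour _ _   (inj₂ (refl , uv)) (inj₁ refl)        = Graph.sym G uv
  common-neighbour _ x≢y (inj₂ (refl , _))  (inj₂ (refl , _))  = contradiction refl x≢y

  Within2⇒JoinAdj : ∀ a b → a ≢ b → Within2 a b → JoinAdj G a b
  Within2⇒JoinAdj (inj₁ p) (inj₁ q) a≢b _ = a≢b ∘ cong inj₁
  Within2⇒JoinAdj (inj₁ _) (inj₂ _) _   _ = tt
  Within2⇒JoinAdj (inj₂ _) (inj₁ _) _   _ = tt
  Within2⇒JoinAdj (inj₂ x) (inj₂ y) a≢b (inj₂ (inj₁ p , xp , py)) =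
    common-neighbour (remQuot n p) (a≢b ∘ cong inj₂) xp py

  incident-combine : ∀ {x} u v → Incident x (u , v) → SplitAdj (inj₂ x) (inj₁ (combine u v))
  incident-combine {x} u v = subst (Incident x) (≡-sym (remQuot-combine u v))

  near-loop : ∀ x p → Within2 (inj₂ x) (inj₁ p)
  near-loop x p with combine x x ≟ p
  ... | yes refl  = inj₁ (incident-combine x x (inj₁ refl))
  ... | no loop≢p = inj₂ (inj₁ (combine x x) , incident-combine x x (inj₁ refl) , loop≢p)

  JoinAdj⇒Within2 : ∀ a b → JoinAdj G a b → Within2 a b
  JoinAdj⇒Within2 (inj₁ p) (inj₁ q) p≢q = inj₁ p≢q
  JoinAdj⇒Within2 (inj₁ p) (inj₂ x) _   = Within2-sym (inj₂ x) (inj₁ p) (near-loop x p)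
  JoinAdj⇒Within2 (inj₂ x) (inj₁ p) _   = near-loop x p
  JoinAdj⇒Within2 (inj₂ x) (inj₂ y) xy  =
    inj₂ (inj₁ (combine x y) , incident-combine x y (inj₁ refl) , incident-combine x y (inj₂ (refl , xy)))

  square-splitGraph-Adj : ∀ u v → Adj (square splitGraph) u v ⇔ JoinAdj G (splitAt K u) (splitAt K v)
  square-splitGraph-Adj u v = mk⇔ to from
    where
    s : Fin (K + n) → Fin K ⊎ Fin n
    s = splitAt K

    to : Adj (square splitGraph) u v → JoinAdj G (s u) (s v)
    to (u≢v , r) = Within2⇒JoinAdj (s u) (s v) (u≢v ∘ splitAt-injective K)
                     (Sum.map₂ (λ { (w , uw , wv) → s w , uw , wv }) r)

    vertex : ∀ {a b} w → SplitAdj a w × SplitAdj w b →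
             SplitAdj a (s (join K n w)) × SplitAdj (s (join K n w)) b
    vertex w rewrite splitAt-join K n w = id

    from : JoinAdj G (s u) (s v) → Adj (square splitGraph) u v
    from j = (JoinAdj⇒≢ G (s u) (s v) j ∘ cong s) ,
             Sum.map₂ (λ { (w , h) → join K n w , vertex w h }) (JoinAdj⇒Within2 (s u) (s v) j)

  square-splitGraph≈cones : square splitGraph ≈ cones K G
  square-splitGraph≈cones = mk≈ λ u v → ⇔.trans (square-splitGraph-Adj u v) (⇔.sym (cones-Adj G K u v))

corollary1 : (∀ (n : ℕ) (G : Graph n) → HadwigerHolds G)
    ⇔ (∀ (n : ℕ) (H : Graph n) → Chordal H → HadwigerHolds (square H))
corollary1 = mk⇔ (λ hadwiger n H _ → hadwiger n (square H)) hadwiger-from-chordal-squares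
  where
  hadwiger-from-chordal-squares : (∀ (n : ℕ) (H : Graph n) → Chordal H → HadwigerHolds (square H)) →
                                  ∀ (n : ℕ) (G : Graph n) → HadwigerHolds G
  hadwiger-from-chordal-squares hadwiger² n G =
    HadwigerHolds-cones⁻ K (HadwigerHolds-≈ square-splitGraph≈cones (hadwiger² (K + n) splitGraph splitGraph-chordal))
    where open SplitConstruction G
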